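{- Let $p$ be a prime and $n\in[1,p-1]$ an integer. An element $\alpha\in\mathcal{O}$ satisfies $\operatorname{tr}(\alpha\zeta^{ -k})\in\{ -n,p-n\}$ for every integer $k$ if and only if $\alpha=\sum_{a\in A}\zeta^a$ for some $n$-element subset $A\subseteq\mathbb{F}_p$.
   Context: $\zeta$ is a fixed primitive $p$-th root of unity (so $\zeta^a$ is well defined for $a\in\mathbb{F}_p=\mathbb{Z}/p\mathbb{Z}$), $\mathbb{K}=\mathbb{Q}(\zeta)$, $\mathcal{O}$ is the ring of integers of $\mathbb{K}$, and $\operatorname{tr}$ is the trace from $\mathbb{K}$ to $\mathbb{Q}$. -}

module Defs where

open import Data.Nat as ℕ using (ℕ; NonZero)
open import Data.Nat.DivMod using (_mod_)
open import Data.Integer as ℤ using (ℤ; +_)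
open import Data.Integer.DivMod using (_%ℕ_)
open import Data.Fin using (Fin; toℕ; zero; suc)

open import Data.Bool using (if_then_else_)
open import Data.Vec using (lookup)
open import Data.Fin.Subset using (Subset)
open import Data.Product using (Σ; ∃; _×_)
open import Data.Rational as ℚ using (ℚ; 0ℚ; 1ℚ)
open import Relation.Binary.PropositionalEquality using (_≡_)

sumFin : {A : Set} → A → (A → A → A) → (m : ℕ) → (Fin m → A) → A
sumFin z _⊕_ ℕ.zero    f = z
sumFin z _⊕_ (ℕ.suc m) f = f zero ⊕ sumFin z _⊕_ m (λ i → f (suc i))

-- The p-th cyclotomic field K = Q(ζ), constructed as the quotient of the
-- group algebra Q[Z/pZ] = Q[x]/(x^p - 1) by the ideal generated by
-- N = 1 + x + ... + x^(p-1); ζ is the class of x.  An element is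
-- represented by a coefficient vector c : F_p → Q (meaning Σ_a c(a) ζ^a);
-- two representatives are equal in K iff they differ by a multiple of N,
-- i.e. iff their difference is constant.
module Cyclotomic (p : ℕ) .{{_ : NonZero p}} where

  Fp : Set
  Fp = Fin p

  ⟦_⟧ : ℤ → Fp
  ⟦ k ⟧ = (k %ℕ p) mod p

  _+F_ : Fp → Fp → Fp
  a +F b = (toℕ a ℕ.+ toℕ b) mod p

  -ᶠ_ : Fp → Fp
  -ᶠ a = ⟦ ℤ.- (+ toℕ a) ⟧

  _*F_ : Fp → Fp → Fp
  a *F b = (toℕ a ℕ.* toℕ b) mod p

  K : Set
  K = Fp → ℚ

  _≈_ : K → K → Set
  x ≈ y = ∀ a b → x a ℚ.- y a ≡ x b ℚ.- y b

  _+K_ : K → K → K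
  (x +K y) a = x a ℚ.+ y a

  0K : K
  0K _ = 0ℚ

  _*K_ : K → K → K
  (x *K y) k = sumFin 0ℚ ℚ._+_ p (λ a → x a ℚ.* y (k +F (-ᶠ a)))

  ι : ℚ → K
  ι q a = if (toℕ a ℕ.≡ᵇ 0) then q else 0ℚ

  ιℤ : ℤ → K
  ιℤ z = ι (z ℚ./ 1)

  1K : K
  1K = ι 1ℚ

  sumK : (m : ℕ) → (Fin m → K) → K
  sumK = sumFin 0K _+K_

  ζ^ : Fp → K
  ζ^ a b = if (toℕ a ℕ.≡ᵇ toℕ b) then 1ℚ else 0ℚ

  ζ^ℤ : ℤ → K
  ζ^ℤ k = ζ^ ⟦ k ⟧

  _^K_ : K → ℕ → K
  x ^K ℕ.zero  = 1K
  x ^K ℕ.suc d = x *K (x ^K d)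

  IsAlgInt : K → Set
  IsAlgInt α = Σ ℕ λ d → Σ (Fin d → ℤ) λ a →
    ((α ^K d) +K sumK d (λ i → ιℤ (a i) *K (α ^K toℕ i))) ≈ 0K

  σ : Fp → K → K
  σ j x = sumK p (λ a → ι (x a) *K ζ^ (j *F a))

  -- trace K → Q (valued in K, lands in ι(Q)): sum of σ_j for j = 1..p-1
  tr : K → K
  tr x = sumK p (λ j → if (toℕ j ℕ.≡ᵇ 0) then 0K else σ j x)

  sumSubset : Subset p → K
  sumSubset A = sumK p (λ a → if lookup A a then ζ^ a else 0K)

{-# OPTIONS --safe #-}
module Submission where

-- For y = Σₐ yₐ ζᵃ one has tr(ζ⁰) = p - 1 and tr(ζᵃ) = -1 for a ≠ 0, so tr y = p·y₀ - Σₐ yₐ;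
-- the constant coefficient of α ζ⁻ᵏ is αₖ.  Hence the hypothesis says exactly that
-- p·αₖ - Σₐ αₐ ∈ {-n, p - n} for every k, i.e. αₖ = c + [k ∈ A] for one constant c, where A is
-- the set of k attaining p - n.  Summing over k gives p·c + |A| = Σₐ αₐ = p·c + n, so |A| = n,
-- and α - Σ_{a ∈ A} ζᵃ = c·(1 + ζ + ⋯ + ζᵖ⁻¹) = 0.  Read backwards, the same computation gives
-- the converse.

open import Defs
open import Level using (0ℓ)
open import Data.Bool using (Bool; true; false; if_then_else_)
open import Data.Empty using (⊥-elim)
open import Data.Fin using (Fin; toℕ; zero; suc)
open import Data.Fin.Properties using (toℕ-fromℕ<; toℕ-injective; toℕ<n; punchInᵢ≢i; suc-injective)
open import Data.Fin.Subset using (Subset; ∣_∣)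
open import Data.Nat as ℕ using (ℕ; zero; suc; NonZero)
open import Data.Nat.Primality using (Prime)
import Data.Nat.Properties as ℕ
open import Data.Product using (Σ; ∃; _×_; _,_; proj₁; proj₂)
open import Data.Sum using (_⊎_; inj₁; inj₂)
open import Data.Vec using ([]; _∷_; lookup; tabulate)
open import Data.Vec.Properties using (lookup∘tabulate)
import Data.Vec.Functional as Vector
open import Function using (_∘_; _∘′_)
open import Function.Bundles using (_⇔_; mk⇔; Equivalence)
open import Algebra.Bundles using (CommutativeMonoid; AbelianGroup)
open import Relation.Binary.PropositionalEquality
  using (_≡_; _≢_; refl; sym; trans; cong; cong₂; subst; module ≡-Reasoning)
open import Relation.Nullary using (yes; no; does)

sumFin≡foldr : ∀ {A : Set} (z : A) (_⊕_ : A → A → A) m (f : Fin m → A) →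
               sumFin z _⊕_ m f ≡ Vector.foldr _⊕_ z f
sumFin≡foldr z _⊕_ zero    f = refl
sumFin≡foldr z _⊕_ (suc m) f = cong (f zero ⊕_) (sumFin≡foldr z _⊕_ m (f ∘ suc))

module SumProperties {c ℓ} (M : CommutativeMonoid c ℓ) where

  open CommutativeMonoid M using (Carrier; _≈_; setoid; ∙-congˡ; identityʳ)
    renaming (ε to 0#; _∙_ to _+_)
  open import Algebra.Properties.CommutativeMonoid.Sum M
    using (sum; sum-remove; sum-cong-≋; sum-replicate-zero)
  open import Relation.Binary.Reasoning.Setoid setoid

  sum-singleSupport : ∀ {n} (f : Fin (suc n) → Carrier) i → (∀ j → j ≢ i → f j ≈ 0#) →
                      sum f ≈ f i
  sum-singleSupport {n} f i vanish = begin
    sum f                                ≈⟨ sum-remove f ⟩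
    f i + sum (Vector.removeAt f i)      ≈⟨ ∙-congˡ (sum-cong-≋ (λ k → vanish _ (punchInᵢ≢i i k))) ⟩
    f i + sum (Vector.replicate n 0#)    ≈⟨ ∙-congˡ (sum-replicate-zero n) ⟩
    f i + 0#                             ≈⟨ identityʳ (f i) ⟩
    f i                                  ∎

module SubtractionProperties {c ℓ} (G : AbelianGroup c ℓ) where

  open AbelianGroup G using (_≈_; _∙_; _-_; setoid; comm; ∙-congʳ; group)
  open import Algebra.Properties.Group group using (x≈z//y; //-rightDividesˡ)
  open import Relation.Binary.Reasoning.Setoid setoid

  x-y≈z⇒x-z≈y : ∀ x y z → x - y ≈ z → x - z ≈ y
  x-y≈z⇒x-z≈y x y z x-y≈z = AbelianGroup.sym G (x≈z//y y z x (begin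
    y ∙ z          ≈⟨ comm y z ⟩
    z ∙ y          ≈⟨ ∙-congʳ x-y≈z ⟨
    (x - y) ∙ y    ≈⟨ //-rightDividesˡ y x ⟩
    x              ∎))

module Rationals where

  open import Data.Nat.Coprimality as Coprime using (1-coprimeTo)
  open import Data.Integer as ℤ using (ℤ; -[1+_])
  import Data.Integer.Properties as ℤ
  open import Data.Rational as ℚ public
    using (ℚ; 0ℚ; 1ℚ; _+_; _*_; -_; _-_; _/_; 1/_; toℚᵘ)
  open import Data.Rational.Properties as ℚ using (normalize-coprime; toℚᵘ-injective; toℚᵘ-homo-+)
  import Data.Rational.Unnormalised as ℚᵘ
  import Data.Rational.Unnormalised.Properties as ℚᵘ
  open import Algebra.Bundles using (Ring)
  open import Relation.Nullary.Decidable using (dec⇒maybe)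
  open import Tactic.RingSolver public using (solve-∀)
  open import Tactic.RingSolver.Core.AlmostCommutativeRing
    using (AlmostCommutativeRing; fromCommutativeRing)
  open import Algebra.Properties.Semiring.Sum (Ring.semiring ℚ.+-*-ring) public
  open SumProperties ℚ.+-0-commutativeMonoid public using (sum-singleSupport)

  ℚ-ring : AlmostCommutativeRing 0ℓ 0ℓ
  ℚ-ring = fromCommutativeRing ℚ.+-*-commutativeRing (λ x → dec⇒maybe (0ℚ ℚ.≟ x))

  toℚᵘ-/1 : ∀ i → toℚᵘ (i / 1) ≡ ℚᵘ.mkℚᵘ i 0
  toℚᵘ-/1 (ℤ.+ n)  = cong toℚᵘ (normalize-coprime (Coprime.sym (1-coprimeTo n)))
  toℚᵘ-/1 -[1+ n ] = cong (toℚᵘ ∘′ -_) (normalize-coprime (Coprime.sym (1-coprimeTo (suc n))))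

  /1-homo-+ : ∀ i j → (i ℤ.+ j) / 1 ≡ i / 1 + j / 1
  /1-homo-+ i j = toℚᵘ-injective (begin
    toℚᵘ ((i ℤ.+ j) / 1)               ≡⟨ toℚᵘ-/1 (i ℤ.+ j) ⟩
    ℚᵘ.mkℚᵘ (i ℤ.+ j) 0                ≈⟨ ℚᵘ.*≡* (cong (ℤ._* ℤ.1ℤ) (sym i*1+j*1≡i+j)) ⟩
    ℚᵘ.mkℚᵘ i 0 ℚᵘ.+ ℚᵘ.mkℚᵘ j 0       ≡⟨ cong₂ ℚᵘ._+_ (toℚᵘ-/1 i) (toℚᵘ-/1 j) ⟨
    toℚᵘ (i / 1) ℚᵘ.+ toℚᵘ (j / 1)     ≈⟨ toℚᵘ-homo-+ (i / 1) (j / 1) ⟨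
    toℚᵘ (i / 1 + j / 1)               ∎)
    where
    open ℚᵘ.≃-Reasoning
    i*1+j*1≡i+j : i ℤ.* ℤ.1ℤ ℤ.+ j ℤ.* ℤ.1ℤ ≡ i ℤ.+ j
    i*1+j*1≡i+j = cong₂ ℤ._+_ (ℤ.*-identityʳ i) (ℤ.*-identityʳ j)

  -- Opaque: unfolding `+ n / 1` for an open `n` sends the type checker into a gcd computation.
  opaque

    fromℕ : ℕ → ℚ
    fromℕ n = ℤ.+ n / 1

    +n/1≡fromℕ : ∀ n → ℤ.+ n / 1 ≡ fromℕ n
    +n/1≡fromℕ n = refl

    -n/1≡-fromℕ : ∀ n → (ℤ.- ℤ.+ n) / 1 ≡ - fromℕ n
    -n/1≡-fromℕ zero    = refl
    -n/1≡-fromℕ (suc n) = refl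

    fromℕ-zero : fromℕ 0 ≡ 0ℚ
    fromℕ-zero = refl

    fromℕ-injective : ∀ {m n} → fromℕ m ≡ fromℕ n → m ≡ n
    fromℕ-injective {m} {n} eq = ℤ.+-injective (begin
      ℤ.+ m                        ≡⟨ cong ℚᵘ.↥_ (toℚᵘ-/1 (ℤ.+ m)) ⟨
      ℚᵘ.↥ toℚᵘ (fromℕ m)          ≡⟨ cong (ℚᵘ.↥_ ∘′ toℚᵘ) eq ⟩
      ℚᵘ.↥ toℚᵘ (fromℕ n)          ≡⟨ cong ℚᵘ.↥_ (toℚᵘ-/1 (ℤ.+ n)) ⟩
      ℤ.+ n                        ∎)
      where open ≡-Reasoning

    fromℕ-nonZero : ∀ n → ℚ.NonZero (fromℕ (suc n))
    fromℕ-nonZero n = subst ℚᵘ.NonZero (sym (toℚᵘ-/1 (ℤ.+ suc n))) _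

  fromℕ-suc : ∀ n → fromℕ (suc n) ≡ 1ℚ + fromℕ n
  fromℕ-suc n = begin
    fromℕ (suc n)              ≡⟨ +n/1≡fromℕ (suc n) ⟨
    ℤ.+ suc n / 1              ≡⟨ /1-homo-+ (ℤ.+ 1) (ℤ.+ n) ⟩
    1ℚ + ℤ.+ n / 1             ≡⟨ cong (1ℚ +_) (+n/1≡fromℕ n) ⟩
    1ℚ + fromℕ n               ∎
    where open ≡-Reasoning

  *-cancelˡ : ∀ r .{{_ : ℚ.NonZero r}} x y → r * x ≡ r * y → x ≡ y
  *-cancelˡ r x y eq = begin
    x                ≡⟨ ℚ.*-identityˡ x ⟨
    1ℚ * x           ≡⟨ cong (_* x) (ℚ.*-inverseˡ r) ⟨
    1/ r * r * x     ≡⟨ ℚ.*-assoc (1/ r) r x ⟩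
    1/ r * (r * x)   ≡⟨ cong (λ t → 1/ r * t) eq ⟩
    1/ r * (r * y)   ≡⟨ ℚ.*-assoc (1/ r) r y ⟨
    1/ r * r * y     ≡⟨ cong (_* y) (ℚ.*-inverseˡ r) ⟩
    1ℚ * y           ≡⟨ ℚ.*-identityˡ y ⟩
    y                ∎
    where open ≡-Reasoning

  x-y≡0⇒x≡y : ∀ x y → x - y ≡ 0ℚ → x ≡ y
  x-y≡0⇒x≡y x y x-y≡0 = begin
    x              ≡⟨ split x y ⟩
    (x - y) + y    ≡⟨ cong (_+ y) x-y≡0 ⟩
    0ℚ + y         ≡⟨ ℚ.+-identityˡ y ⟩
    y              ∎
    where
    open ≡-Reasoning
    split : ∀ x y → x ≡ (x - y) + y
    split = solve-∀ ℚ-ring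

  sum-const : ∀ m c → sum {m} (λ _ → c) ≡ fromℕ m * c
  sum-const zero    c = sym (trans (cong (_* c) fromℕ-zero) (ℚ.*-zeroˡ c))
  sum-const (suc m) c = begin
    c + sum {m} (λ _ → c)  ≡⟨ cong (λ t → c + t) (sum-const m c) ⟩
    c + fromℕ m * c        ≡⟨ distrib c (fromℕ m) ⟩
    (1ℚ + fromℕ m) * c     ≡⟨ cong (_* c) (fromℕ-suc m) ⟨
    fromℕ (suc m) * c      ∎
    where
    open ≡-Reasoning
    distrib : ∀ c x → c + x * c ≡ (1ℚ + x) * c
    distrib = solve-∀ ℚ-ring

  sum-affine : ∀ {m} c (g : Fin m → ℚ) d → sum (λ b → c * g b - d) ≡ c * sum g - fromℕ m * d
  sum-affine {m} c g d = begin
    sum (λ b → c * g b - d)                    ≡⟨ ∑-distrib-+ (λ b → c * g b) (λ _ → - d) ⟩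
    sum (λ b → c * g b) + sum {m} (λ _ → - d)  ≡⟨ cong₂ _+_ (sym (*-distribˡ-sum c g)) (sum-const m (- d)) ⟩
    c * sum g + fromℕ m * - d                  ≡⟨ neg-distrib c (sum g) (fromℕ m) d ⟩
    c * sum g - fromℕ m * d                    ∎
    where
    open ≡-Reasoning
    neg-distrib : ∀ c s k d → c * s + k * - d ≡ c * s - k * d
    neg-distrib = solve-∀ ℚ-ring

module Residues (r : ℕ) where

  open import Data.Nat using (_+_; _*_; _%_; _<_)
  open import Data.Nat.DivMod
    using (_mod_; %-distribˡ-+; %-distribˡ-*; m%n%n≡m%n; m<n⇒m%n≡m; m%n<n; n%n≡0; [m+kn]%n≡m%n; [m+n]%n≡m%n)
  open import Data.Nat.Coprimality using (prime⇒coprime; coprime-Bézout)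
  open import Data.Nat.GCD using (module Bézout)
  open import Data.Nat.Tactic.RingSolver using (solve-∀)
  import Data.Integer as ℤ
  open import Data.Integer.DivMod using (_%ℕ_)
  open import Algebra.Structures using (IsAbelianGroup)
  open import Algebra.Consequences.Propositional using (comm∧idˡ⇒id; comm∧invˡ⇒inv)
  open import Algebra.Properties.CommutativeSemigroup ℕ.*-commutativeSemigroup using (x∙yz≈xz∙y)
  open import Relation.Binary.Bundles using (Setoid)
  open import Relation.Binary.PropositionalEquality using (isEquivalence)
  import Relation.Binary.Reasoning.Setoid as SetoidReasoning

  open Cyclotomic (suc r)

  p : ℕ
  p = suc r

  -- A record rather than a synonym for `m % p ≡ n % p`, so that `m` and `n` can be inferred.
  infix 4 _≡ₘ_
  record _≡ₘ_ (m n : ℕ) : Set where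
    constructor reduce
    field reduce≡ : m % p ≡ n % p

  ≡ₘ-setoid : Setoid 0ℓ 0ℓ
  ≡ₘ-setoid = record
    { _≈_ = _≡ₘ_
    ; isEquivalence = record
      { refl  = reduce refl
      ; sym   = λ (reduce eq) → reduce (sym eq)
      ; trans = λ (reduce eq) (reduce eq′) → reduce (trans eq eq′)
      }
    }

  module ≡ₘ-Reasoning = SetoidReasoning ≡ₘ-setoid

  +-congₘ : ∀ {m m′ n n′} → m ≡ₘ m′ → n ≡ₘ n′ → m + n ≡ₘ m′ + n′
  +-congₘ {m} {m′} {n} {n′} (reduce eq) (reduce eq′) = reduce (begin
    (m + n) % p              ≡⟨ %-distribˡ-+ m n p ⟩
    (m % p + n % p) % p      ≡⟨ cong₂ (λ x y → (x + y) % p) eq eq′ ⟩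
    (m′ % p + n′ % p) % p    ≡⟨ %-distribˡ-+ m′ n′ p ⟨
    (m′ + n′) % p            ∎)
    where open ≡-Reasoning

  *-congₘ : ∀ {m m′ n n′} → m ≡ₘ m′ → n ≡ₘ n′ → m * n ≡ₘ m′ * n′
  *-congₘ {m} {m′} {n} {n′} (reduce eq) (reduce eq′) = reduce (begin
    (m * n) % p              ≡⟨ %-distribˡ-* m n p ⟩
    (m % p * (n % p)) % p    ≡⟨ cong₂ (λ x y → (x * y) % p) eq eq′ ⟩
    (m′ % p * (n′ % p)) % p  ≡⟨ %-distribˡ-* m′ n′ p ⟨
    (m′ * n′) % p            ∎)
    where open ≡-Reasoning

  +-congˡₘ : ∀ m {n n′} → n ≡ₘ n′ → m + n ≡ₘ m + n′
  +-congˡₘ m = +-congₘ {m} {m} (reduce refl)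

  +-congʳₘ : ∀ {m m′} n → m ≡ₘ m′ → m + n ≡ₘ m′ + n
  +-congʳₘ n eq = +-congₘ {n = n} {n} eq (reduce refl)

  *-congˡₘ : ∀ m {n n′} → n ≡ₘ n′ → m * n ≡ₘ m * n′
  *-congˡₘ m = *-congₘ {m} {m} (reduce refl)

  *-congʳₘ : ∀ {m m′} n → m ≡ₘ m′ → m * n ≡ₘ m′ * n
  *-congʳₘ n eq = *-congₘ {n = n} {n} eq (reduce refl)

  toℕ-mod : ∀ m → toℕ (m mod p) ≡ₘ m
  toℕ-mod m = reduce (trans (cong (_% p) (toℕ-fromℕ< (m%n<n m p))) (m%n%n≡m%n m p))

  toℕ-+F : ∀ a b → toℕ (a +F b) ≡ₘ toℕ a + toℕ b
  toℕ-+F a b = toℕ-mod (toℕ a + toℕ b)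

  toℕ-*F : ∀ a b → toℕ (a *F b) ≡ₘ toℕ a * toℕ b
  toℕ-*F a b = toℕ-mod (toℕ a * toℕ b)

  toℕ-injectiveₘ : {a b : Fp} → toℕ a ≡ₘ toℕ b → a ≡ b
  toℕ-injectiveₘ {a} {b} (reduce eq) =
    toℕ-injective (trans (sym (m<n⇒m%n≡m (toℕ<n a))) (trans eq (m<n⇒m%n≡m (toℕ<n b))))

  +F-comm : ∀ a b → a +F b ≡ b +F a
  +F-comm a b = cong (_mod p) (ℕ.+-comm (toℕ a) (toℕ b))

  +F-assoc : ∀ a b c → (a +F b) +F c ≡ a +F (b +F c)
  +F-assoc a b c = toℕ-injectiveₘ (begin
    toℕ ((a +F b) +F c)           ≈⟨ toℕ-+F (a +F b) c ⟩
    toℕ (a +F b) + toℕ c          ≈⟨ +-congʳₘ (toℕ c) (toℕ-+F a b) ⟩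
    toℕ a + toℕ b + toℕ c         ≡⟨ ℕ.+-assoc (toℕ a) _ _ ⟩
    toℕ a + (toℕ b + toℕ c)       ≈⟨ +-congˡₘ (toℕ a) (toℕ-+F b c) ⟨
    toℕ a + toℕ (b +F c)          ≈⟨ toℕ-+F a (b +F c) ⟨
    toℕ (a +F (b +F c))           ∎)
    where open ≡ₘ-Reasoning

  +F-identityˡ : ∀ a → zero +F a ≡ a
  +F-identityˡ a = toℕ-injectiveₘ (toℕ-mod (toℕ a))

  -ℤ%ℕ-inverseˡ : ∀ n → n < p → (ℤ.- ℤ.+ n) %ℕ p + n ≡ₘ 0
  -ℤ%ℕ-inverseˡ zero    _   = reduce (m%n%n≡m%n 0 p)
  -ℤ%ℕ-inverseˡ (suc n) n<p with suc n % p | m<n⇒m%n≡m n<p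
  ... | .(suc n) | refl = reduce (trans (cong (_% p) (ℕ.m∸n+n≡m (ℕ.<⇒≤ n<p))) (n%n≡0 p))

  -F-inverseˡ : ∀ a → (-ᶠ a) +F a ≡ zero
  -F-inverseˡ a = toℕ-injectiveₘ (begin
    toℕ ((-ᶠ a) +F a)                    ≈⟨ toℕ-+F (-ᶠ a) a ⟩
    toℕ (-ᶠ a) + toℕ a                   ≈⟨ +-congʳₘ (toℕ a) (toℕ-mod _) ⟩
    (ℤ.- ℤ.+ toℕ a) %ℕ p + toℕ a         ≈⟨ -ℤ%ℕ-inverseˡ (toℕ a) (toℕ<n a) ⟩
    0                                    ∎)
    where open ≡ₘ-Reasoning

  +F-isAbelianGroup : IsAbelianGroup _≡_ _+F_ zero -ᶠ_
  +F-isAbelianGroup = record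
    { isGroup = record
      { isMonoid = record
        { isSemigroup = record
          { isMagma = record { isEquivalence = isEquivalence ; ∙-cong = cong₂ _+F_ }
          ; assoc   = +F-assoc
          }
        ; identity = comm∧idˡ⇒id +F-comm +F-identityˡ
        }
      ; inverse = comm∧invˡ⇒inv +F-comm -F-inverseˡ
      ; ⁻¹-cong = cong -ᶠ_
      }
    ; comm = +F-comm
    }

  +F-abelianGroup : AbelianGroup 0ℓ 0ℓ
  +F-abelianGroup = record { isAbelianGroup = +F-isAbelianGroup }

  open AbelianGroup +F-abelianGroup public using () renaming (_-_ to _-F_)
  open SubtractionProperties +F-abelianGroup public using (x-y≈z⇒x-z≈y)

  *F-zeroˡ : ∀ a → zero *F a ≡ zero
  *F-zeroˡ a = refl

  *F-zeroʳ : ∀ a → a *F zero ≡ zero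
  *F-zeroʳ a = cong (_mod p) (ℕ.*-zeroʳ (toℕ a))

  inverseₘ : Prime p → (a : Fp) → a ≢ zero → ∃ λ u → u * toℕ a ≡ₘ 1
  inverseₘ p-prime zero      a≢0 = ⊥-elim (a≢0 refl)
  inverseₘ p-prime a@(suc _) _   with coprime-Bézout (prime⇒coprime p-prime (toℕ<n a))
  ... | Bézout.-+ x y eq = y , (begin
    y * toℕ a        ≡⟨ eq ⟨
    1 + x * p        ≈⟨ reduce ([m+kn]%n≡m%n 1 x p) ⟩
    1                ∎)
    where open ≡ₘ-Reasoning
  ... | Bézout.+- x y eq = r * y , (begin
    r * y * toℕ a            ≈⟨ reduce ([m+n]%n≡m%n (r * y * toℕ a) p) ⟨
    r * y * toℕ a + p        ≡⟨ regroup r y (toℕ a) ⟩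
    1 + r * (1 + y * toℕ a)  ≡⟨ cong (λ t → 1 + r * t) eq ⟩
    1 + r * (x * p)          ≡⟨ cong (λ t → 1 + t) (ℕ.*-assoc r x p) ⟨
    1 + r * x * p            ≈⟨ reduce ([m+kn]%n≡m%n 1 (r * x) p) ⟩
    1                        ∎)
    where
    open ≡ₘ-Reasoning
    regroup : ∀ r y a → r * y * a + suc r ≡ 1 + r * (1 + y * a)
    regroup = solve-∀

  module _ (p-prime : Prime p) {a : Fp} (a≢0 : a ≢ zero) where

    private
      u : ℕ
      u = proj₁ (inverseₘ p-prime a a≢0)
      u*a≡1 : u * toℕ a ≡ₘ 1
      u*a≡1 = proj₂ (inverseₘ p-prime a a≢0)

    *F-cancelʳ : ∀ j j′ → j *F a ≡ j′ *F a → j ≡ j′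
    *F-cancelʳ j j′ eq = toℕ-injectiveₘ (begin
      toℕ j                    ≈⟨ recover j ⟩
      toℕ (j *F a) * u         ≡⟨ cong (λ t → toℕ t * u) eq ⟩
      toℕ (j′ *F a) * u        ≈⟨ recover j′ ⟨
      toℕ j′                   ∎)
      where
      open ≡ₘ-Reasoning
      recover : ∀ j → toℕ j ≡ₘ toℕ (j *F a) * u
      recover j = begin
        toℕ j                  ≡⟨ ℕ.*-identityʳ (toℕ j) ⟨
        toℕ j * 1              ≈⟨ *-congˡₘ (toℕ j) u*a≡1 ⟨
        toℕ j * (u * toℕ a)    ≡⟨ x∙yz≈xz∙y (toℕ j) u (toℕ a) ⟩
        toℕ j * toℕ a * u      ≈⟨ *-congʳₘ u (toℕ-*F j a) ⟨
        toℕ (j *F a) * u       ∎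

    *F-solvable : ∀ b → ∃ λ j → j *F a ≡ b
    *F-solvable b = j , toℕ-injectiveₘ (begin
      toℕ (j *F a)             ≈⟨ toℕ-*F j a ⟩
      toℕ j * toℕ a            ≈⟨ *-congʳₘ (toℕ a) (toℕ-mod (toℕ b * u)) ⟩
      toℕ b * u * toℕ a        ≡⟨ ℕ.*-assoc (toℕ b) u (toℕ a) ⟩
      toℕ b * (u * toℕ a)      ≈⟨ *-congˡₘ (toℕ b) u*a≡1 ⟩
      toℕ b * 1                ≡⟨ ℕ.*-identityʳ (toℕ b) ⟩
      toℕ b                    ∎)
      where
      open ≡ₘ-Reasoning
      j : Fp
      j = (toℕ b * u) mod p

module IndicatorCharacterisation where

  open Rationals
  open import Data.Rational.Properties as ℚ using (_≟_)

  fromBool : Bool → ℚ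
  fromBool β = if β then 1ℚ else 0ℚ

  indicator : ∀ {m} → Subset m → Fin m → ℚ
  indicator A = fromBool ∘ lookup A

  sum-indicator : ∀ {m} (A : Subset m) → sum (indicator A) ≡ fromℕ ∣ A ∣
  sum-indicator []          = sym fromℕ-zero
  sum-indicator (true ∷ A)  = trans (cong (1ℚ +_) (sum-indicator A)) (sym (fromℕ-suc ∣ A ∣))
  sum-indicator (false ∷ A) = trans (cong (0ℚ +_) (sum-indicator A)) (ℚ.+-identityˡ (fromℕ ∣ A ∣))

  DiffersByConstant : ∀ {m} (f g : Fin m → ℚ) → Set
  DiffersByConstant f g = ∀ u v → f u - g u ≡ f v - g v

  deviation : ∀ {m} → (Fin (suc m) → ℚ) → Fin (suc m) → ℚ
  deviation {m} f b = fromℕ (suc m) * f b - sum f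

  sum-deviation : ∀ {m} (f : Fin (suc m) → ℚ) → sum (deviation f) ≡ 0ℚ
  sum-deviation {m} f =
    trans (sum-affine (fromℕ (suc m)) f (sum f)) (ℚ.+-inverseʳ (fromℕ (suc m) * sum f))

  module _ (m n : ℕ) where

    private
      M N : ℚ
      M = fromℕ (suc m)
      N = fromℕ n

      M*1-N≡M-N : M * 1ℚ - N ≡ M - N
      M*1-N≡M-N = cong (_- N) (ℚ.*-identityʳ M)

      M*0-N≡-N : M * 0ℚ - N ≡ - N
      M*0-N≡-N = trans (cong (_- N) (ℚ.*-zeroʳ M)) (ℚ.+-identityˡ (- N))

      M*-cancel : ∀ x y → M * x ≡ M * y → x ≡ y
      M*-cancel = *-cancelˡ M {{fromℕ-nonZero m}}

    Admissible : ℚ → Set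
    Admissible v = v ≡ - N ⊎ v ≡ M - N

    admissible-fromBool : ∀ β → Admissible (M * fromBool β - N)
    admissible-fromBool true  = inj₂ M*1-N≡M-N
    admissible-fromBool false = inj₁ M*0-N≡-N

    admissible⇒fromBool : ∀ {v} → Admissible v → v ≡ M * fromBool (does (v ≟ M - N)) - N
    admissible⇒fromBool {v} admissible with v ≟ M - N | admissible
    ... | yes v≡M-N | _          = trans v≡M-N (sym M*1-N≡M-N)
    ... | no  _     | inj₁ v≡-N  = trans v≡-N (sym M*0-N≡-N)
    ... | no  v≢M-N | inj₂ v≡M-N = ⊥-elim (v≢M-N v≡M-N)

    module _ (f : Fin (suc m) → ℚ) where

      IndicatorShape : Set
      IndicatorShape = Σ (Subset (suc m)) λ A → ∣ A ∣ ≡ n × DiffersByConstant f (indicator A)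

      admissible⇒indicatorShape : (∀ b → Admissible (deviation f b)) → IndicatorShape
      admissible⇒indicatorShape admissible = A , card , differsByConstant
        where
        open ≡-Reasoning

        A : Subset (suc m)
        A = tabulate (λ b → does (deviation f b ≟ M - N))

        deviation≡ : ∀ b → deviation f b ≡ M * indicator A b - N
        deviation≡ b rewrite lookup∘tabulate (λ b → does (deviation f b ≟ M - N)) b =
          admissible⇒fromBool (admissible b)

        scaled : ∀ u → M * (f u - indicator A u) ≡ sum f - N
        scaled u = begin
          M * (f u - i)                      ≡⟨ expand M (f u) i (sum f) ⟩
          (M * f u - sum f) - M * i + sum f  ≡⟨ cong (λ t → t - M * i + sum f) (deviation≡ u) ⟩
          (M * i - N) - M * i + sum f        ≡⟨ collapse M i N (sum f) ⟩
          sum f - N                          ∎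
          where
          i : ℚ
          i = indicator A u
          expand : ∀ M x i s → M * (x - i) ≡ (M * x - s) - M * i + s
          expand = solve-∀ ℚ-ring
          collapse : ∀ M i N s → (M * i - N) - M * i + s ≡ s - N
          collapse = solve-∀ ℚ-ring

        differsByConstant : DiffersByConstant f (indicator A)
        differsByConstant u v = M*-cancel _ _ (trans (scaled u) (sym (scaled v)))

        M*∑indicator≡M*N : M * sum (indicator A) ≡ M * N
        M*∑indicator≡M*N = x-y≡0⇒x≡y (M * sum (indicator A)) (M * N) (begin
          M * sum (indicator A) - M * N      ≡⟨ sum-affine M (indicator A) N ⟨
          sum (λ b → M * indicator A b - N)  ≡⟨ sum-cong-≗ deviation≡ ⟨
          sum (deviation f)                  ≡⟨ sum-deviation f ⟩
          0ℚ                                 ∎)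

        card : ∣ A ∣ ≡ n
        card = fromℕ-injective (M*-cancel (fromℕ ∣ A ∣) N
                 (trans (cong (M *_) (sym (sum-indicator A))) M*∑indicator≡M*N))

      indicatorShape⇒admissible : IndicatorShape → ∀ b → Admissible (deviation f b)
      indicatorShape⇒admissible (A , card , differsByConstant) b =
        subst Admissible (sym deviation≡) (admissible-fromBool (lookup A b))
        where
        open ≡-Reasoning
        d : ℚ
        d = f zero - indicator A zero

        f≡ : ∀ u → f u ≡ indicator A u + d
        f≡ u = trans (split (f u) (indicator A u)) (cong (indicator A u +_) (differsByConstant u zero))
          where
          split : ∀ x i → x ≡ i + (x - i)
          split = solve-∀ ℚ-ring

        sum≡ : sum f ≡ N + M * d
        sum≡ = begin
          sum f                                      ≡⟨ sum-cong-≗ f≡ ⟩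
          sum (λ u → indicator A u + d)              ≡⟨ ∑-distrib-+ (indicator A) (λ _ → d) ⟩
          sum (indicator A) + sum {suc m} (λ _ → d)  ≡⟨ cong₂ _+_ (trans (sum-indicator A) (cong fromℕ card))
                                                                (sum-const (suc m) d) ⟩
          N + M * d                                  ∎

        deviation≡ : deviation f b ≡ M * indicator A b - N
        deviation≡ = begin
          M * f b - sum f                        ≡⟨ cong₂ (λ x s → M * x - s) (f≡ b) sum≡ ⟩
          M * (indicator A b + d) - (N + M * d)  ≡⟨ collapse M (indicator A b) d N ⟩
          M * indicator A b - N                  ∎
          where
          collapse : ∀ M i d N → M * (i + d) - (N + M * d) ≡ M * i - N
          collapse = solve-∀ ℚ-ring

      admissible⇔indicatorShape : (∀ b → Admissible (deviation f b)) ⇔ IndicatorShape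
      admissible⇔indicatorShape = mk⇔ admissible⇒indicatorShape indicatorShape⇒admissible

module Coefficients (r : ℕ) where

  open Cyclotomic (suc r)
  open Residues r
  open Rationals
  open IndicatorCharacterisation using (fromBool; indicator; DiffersByConstant; deviation)
  import Data.Rational.Properties as ℚ
  open import Data.Bool.Properties using (T-≡)
  open import Data.Fin.Permutation using (Permutation′; permutation)
  open AbelianGroup +F-abelianGroup using (identityʳ)
  open import Algebra.Properties.Group (AbelianGroup.group +F-abelianGroup)
    using (ε⁻¹≈ε; //-rightDividesˡ; //-rightDividesʳ)

  ζ^-diag : ∀ a → ζ^ a a ≡ 1ℚ
  ζ^-diag a rewrite Equivalence.to T-≡ (ℕ.≡⇒≡ᵇ (toℕ a) (toℕ a) refl) = refl

  ζ^-off : ∀ {a b} → a ≢ b → ζ^ a b ≡ 0ℚ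
  ζ^-off {a} {b} a≢b with toℕ a ℕ.≡ᵇ toℕ b in eq
  ... | false = refl
  ... | true  = ⊥-elim (a≢b (toℕ-injective (ℕ.≡ᵇ⇒≡ _ _ (Equivalence.from T-≡ eq))))

  *-ζ^-diag : ∀ c a → c * ζ^ a a ≡ c
  *-ζ^-diag c a = trans (cong (c *_) (ζ^-diag a)) (ℚ.*-identityʳ c)

  *-ζ^-off : ∀ c a b → a ≢ b → c * ζ^ a b ≡ 0ℚ
  *-ζ^-off c a b a≢b = trans (cong (c *_) (ζ^-off a≢b)) (ℚ.*-zeroʳ c)

  sumK-apply : ∀ m (G : Fin m → K) b → sumK m G b ≡ sum (λ i → G i b)
  sumK-apply zero    G b = refl
  sumK-apply (suc m) G b = cong (G zero b +_) (sumK-apply m (G ∘ suc) b)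

  *K-apply : ∀ x y t → (x *K y) t ≡ sum (λ a → x a * y (t -F a))
  *K-apply x y t = sumFin≡foldr 0ℚ _+_ (suc r) (λ a → x a * y (t -F a))

  *K-ζ^ : ∀ x m t → (x *K ζ^ m) t ≡ x (t -F m)
  *K-ζ^ x m t = begin
    (x *K ζ^ m) t                          ≡⟨ *K-apply x (ζ^ m) t ⟩
    sum (λ a → x a * ζ^ m (t -F a))        ≡⟨ sum-singleSupport (λ a → x a * ζ^ m (t -F a)) (t -F m) vanish ⟩
    x (t -F m) * ζ^ m (t -F (t -F m))      ≡⟨ cong (λ b → x (t -F m) * ζ^ m b) t-[t-m]≡m ⟩
    x (t -F m) * ζ^ m m                    ≡⟨ *-ζ^-diag (x (t -F m)) m ⟩
    x (t -F m)                             ∎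
    where
    open ≡-Reasoning
    t-[t-m]≡m : t -F (t -F m) ≡ m
    t-[t-m]≡m = x-y≈z⇒x-z≈y t m (t -F m) refl
    vanish : ∀ a → a ≢ t -F m → x a * ζ^ m (t -F a) ≡ 0ℚ
    vanish a a≢t-m = *-ζ^-off (x a) m (t -F a)
      (λ m≡t-a → a≢t-m (sym (x-y≈z⇒x-z≈y t a m (sym m≡t-a))))

  ι-*K-apply : ∀ c y b → (ι c *K y) b ≡ c * y b
  ι-*K-apply c y b = begin
    (ι c *K y) b                           ≡⟨ *K-apply (ι c) y b ⟩
    sum (λ a → ι c a * y (b -F a))         ≡⟨ sum-singleSupport (λ a → ι c a * y (b -F a)) zero vanish ⟩
    c * y (b -F zero)                      ≡⟨ cong (λ a → c * y a) b-0≡b ⟩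
    c * y b                                ∎
    where
    open ≡-Reasoning
    vanish : ∀ a → a ≢ zero → ι c a * y (b -F a) ≡ 0ℚ
    vanish zero    a≢0 = ⊥-elim (a≢0 refl)
    vanish (suc a) _   = ℚ.*-zeroˡ (y (b -F suc a))
    b-0≡b : b -F zero ≡ b
    b-0≡b = trans (cong (b +F_) ε⁻¹≈ε) (identityʳ b)

  σ-apply : ∀ j y b → σ j y b ≡ sum (λ a → y a * ζ^ (j *F a) b)
  σ-apply j y b = trans (sumK-apply (suc r) (λ a → ι (y a) *K ζ^ (j *F a)) b)
                        (sum-cong-≗ (λ a → ι-*K-apply (y a) (ζ^ (j *F a)) b))

  sum-*K-ζ^ : ∀ x m → sum (x *K ζ^ m) ≡ sum x
  sum-*K-ζ^ x m = trans (sum-cong-≗ (*K-ζ^ x m)) (sym (∑-permute x translation))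
    where
    translation : Permutation′ (suc r)
    translation = permutation (_-F m) (_+F m) (//-rightDividesʳ m) (//-rightDividesˡ m)

  deviation-*K-ζ^ : ∀ x m → deviation (x *K ζ^ m) zero ≡ deviation x (zero -F m)
  deviation-*K-ζ^ x m = cong₂ (λ a s → fromℕ (suc r) * a - s) (*K-ζ^ x m zero) (sum-*K-ζ^ x m)

  sumSubset-apply : ∀ A b → sumSubset A b ≡ indicator A b
  sumSubset-apply A b = begin
    sumSubset A b          ≡⟨ sumK-apply (suc r) G b ⟩
    sum (λ a → G a b)      ≡⟨ sum-singleSupport (λ a → G a b) b vanish ⟩
    G b b                  ≡⟨ diag (lookup A b) ⟩
    indicator A b          ∎
    where
    open ≡-Reasoning
    G : Fp → K
    G a = if lookup A a then ζ^ a else 0K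
    vanish : ∀ a → a ≢ b → G a b ≡ 0ℚ
    vanish a a≢b with lookup A a
    ... | true  = ζ^-off a≢b
    ... | false = refl
    diag : ∀ β → (if β then ζ^ b else 0K) b ≡ fromBool β
    diag true  = ζ^-diag b
    diag false = refl

  ≈-respʳ : ∀ x y z → (∀ b → y b ≡ z b) → x ≈ y → x ≈ z
  ≈-respʳ x y z y≗z x≈y u v = begin
    x u - z u    ≡⟨ cong (λ t → x u - t) (y≗z u) ⟨
    x u - y u    ≡⟨ x≈y u v ⟩
    x v - y v    ≡⟨ cong (λ t → x v - t) (y≗z v) ⟩
    x v - z v    ∎
    where open ≡-Reasoning

  ≈sumSubset⇔ : ∀ x A → x ≈ sumSubset A ⇔ DiffersByConstant x (indicator A)
  ≈sumSubset⇔ x A = mk⇔ (≈-respʳ x (sumSubset A) (indicator A) (sumSubset-apply A))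
                        (≈-respʳ x (indicator A) (sumSubset A) (sym ∘ sumSubset-apply A))

module Trace (q : ℕ) (p-prime : Prime (suc (suc q))) where

  open Cyclotomic (suc (suc q))
  open Residues (suc q)
  open Coefficients (suc q)
  open Rationals
  import Data.Rational.Properties as ℚ
  open IndicatorCharacterisation using (deviation)

  sum-ζ^-*F-zero : ∀ c b → b ≢ zero → sum (λ j → c * ζ^ (suc j *F zero) b) ≡ 0ℚ
  sum-ζ^-*F-zero c b b≢0 = trans (sum-cong-≗ vanish) (sum-replicate-zero (suc q))
    where
    vanish : ∀ j → c * ζ^ (suc j *F zero) b ≡ 0ℚ
    vanish j = trans (cong (λ a → c * ζ^ a b) (*F-zeroʳ (suc j))) (*-ζ^-off c zero b (b≢0 ∘ sym))

  sum-ζ^-*F-nonzero : ∀ c {a} → a ≢ zero → ∀ b → b ≢ zero → sum (λ j → c * ζ^ (suc j *F a) b) ≡ c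
  sum-ζ^-*F-nonzero c {a} a≢0 b b≢0 = column (*F-solvable p-prime a≢0 b)
    where
    column : (∃ λ j₀ → j₀ *F a ≡ b) → sum (λ j → c * ζ^ (suc j *F a) b) ≡ c
    column (zero , 0≡b) = ⊥-elim (b≢0 (trans (sym 0≡b) (*F-zeroˡ a)))
    column (suc j₀ , j₀a≡b) = begin
      sum (λ j → c * ζ^ (suc j *F a) b)   ≡⟨ sum-singleSupport (λ j → c * ζ^ (suc j *F a) b) j₀ vanish ⟩
      c * ζ^ (suc j₀ *F a) b              ≡⟨ cong (λ t → c * ζ^ t b) j₀a≡b ⟩
      c * ζ^ b b                          ≡⟨ *-ζ^-diag c b ⟩
      c                                   ∎
      where
      open ≡-Reasoning
      vanish : ∀ j → j ≢ j₀ → c * ζ^ (suc j *F a) b ≡ 0ℚ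
      vanish j j≢j₀ = *-ζ^-off c (suc j *F a) b (λ ja≡b → j≢j₀ (suc-injective (cancel (trans ja≡b (sym j₀a≡b)))))
        where
        cancel : suc j *F a ≡ suc j₀ *F a → suc j ≡ suc j₀
        cancel = *F-cancelʳ p-prime a≢0 (suc j) (suc j₀)

  σ-apply-zero : ∀ j y → j ≢ zero → σ j y zero ≡ y zero
  σ-apply-zero j y j≢0 = begin
    σ j y zero                              ≡⟨ σ-apply j y zero ⟩
    sum (λ a → y a * ζ^ (j *F a) zero)      ≡⟨ sum-singleSupport (λ a → y a * ζ^ (j *F a) zero) zero vanish ⟩
    y zero * ζ^ (j *F zero) zero            ≡⟨ cong (λ a → y zero * ζ^ a zero) (*F-zeroʳ j) ⟩
    y zero * ζ^ zero zero                   ≡⟨ *-ζ^-diag (y zero) zero ⟩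
    y zero                                  ∎
    where
    open ≡-Reasoning
    vanish : ∀ a → a ≢ zero → y a * ζ^ (j *F a) zero ≡ 0ℚ
    vanish a a≢0 = *-ζ^-off (y a) (j *F a) zero (j≢0 ∘ *F-cancelʳ p-prime a≢0 j zero)

  tr-apply : ∀ y b → tr y b ≡ 0ℚ + sum (λ j → σ (suc j) y b)
  tr-apply y b = sumK-apply (suc (suc q)) (λ j → if toℕ j ℕ.≡ᵇ 0 then 0K else σ j y) b

  tr-apply-zero : ∀ y → tr y zero ≡ fromℕ (suc q) * y zero
  tr-apply-zero y = begin
    tr y zero                            ≡⟨ tr-apply y zero ⟩
    0ℚ + sum (λ j → σ (suc j) y zero)    ≡⟨ ℚ.+-identityˡ (sum (λ j → σ (suc j) y zero)) ⟩
    sum (λ j → σ (suc j) y zero)         ≡⟨ sum-cong-≗ (λ j → σ-apply-zero (suc j) y (λ ())) ⟩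
    sum {suc q} (λ _ → y zero)           ≡⟨ sum-const (suc q) (y zero) ⟩
    fromℕ (suc q) * y zero               ∎
    where open ≡-Reasoning

  tr-apply-suc : ∀ y b → tr y (suc b) ≡ sum (λ a → y (suc a))
  tr-apply-suc y b = begin
    tr y (suc b)                                      ≡⟨ tr-apply y (suc b) ⟩
    0ℚ + ∑σ                                           ≡⟨ ℚ.+-identityˡ ∑σ ⟩
    ∑σ                                                ≡⟨ sum-cong-≗ (λ j → σ-apply (suc j) y (suc b)) ⟩
    sum (λ j → sum (λ a → term j a))                  ≡⟨ ∑-comm term ⟩
    sum (λ j → term j zero)
      + sum (λ a → sum (λ j → term j (suc a)))        ≡⟨ cong₂ _+_ column-zero (sum-cong-≗ column-suc) ⟩
    0ℚ + sum (λ a → y (suc a))                        ≡⟨ ℚ.+-identityˡ (sum (λ a → y (suc a))) ⟩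
    sum (λ a → y (suc a))                             ∎
    where
    open ≡-Reasoning
    ∑σ : ℚ
    ∑σ = sum (λ j → σ (suc j) y (suc b))
    term : Fin (suc q) → Fp → ℚ
    term j a = y a * ζ^ (suc j *F a) (suc b)
    column-zero : sum (λ j → term j zero) ≡ 0ℚ
    column-zero = sum-ζ^-*F-zero (y zero) (suc b) (λ ())
    column-suc : ∀ a → sum (λ j → term j (suc a)) ≡ y (suc a)
    column-suc a = sum-ζ^-*F-nonzero (y (suc a)) {suc a} (λ ()) (suc b) (λ ())

  tr-ι-difference : ∀ y b → tr y b - ι (deviation y zero) b ≡ sum (λ a → y (suc a))
  tr-ι-difference y zero = begin
    tr y zero - deviation y zero                     ≡⟨ cong₂ _-_ (tr-apply-zero y) p·y₀≡ ⟩
    E * y zero - ((1ℚ + E) * y zero - (y zero + T))  ≡⟨ cancel E (y zero) T ⟩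
    T                                                ∎
    where
    open ≡-Reasoning
    E T : ℚ
    E = fromℕ (suc q)
    T = sum (λ a → y (suc a))
    p·y₀≡ : deviation y zero ≡ (1ℚ + E) * y zero - (y zero + T)
    p·y₀≡ = cong (λ E → E * y zero - sum y) (fromℕ-suc (suc q))
    cancel : ∀ E y₀ T → E * y₀ - ((1ℚ + E) * y₀ - (y₀ + T)) ≡ T
    cancel = solve-∀ ℚ-ring
  tr-ι-difference y (suc b) = trans (ℚ.+-identityʳ (tr y (suc b))) (tr-apply-suc y b)

  tr≈ι⇔ : ∀ y c → tr y ≈ ι c ⇔ deviation y zero ≡ c
  tr≈ι⇔ y c = mk⇔ to from
    where
    D T : ℚ
    D = deviation y zero
    T = sum (λ a → y (suc a))

    to : tr y ≈ ι c → D ≡ c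
    to tr≈ι = x-y≡0⇒x≡y D c (begin
      D - c                                 ≡⟨ rearrange (tr y zero) D c ⟩
      (tr y zero - c) - (tr y zero - D)     ≡⟨ cong₂ _-_ (tr≈ι zero (suc zero)) (tr-ι-difference y zero) ⟩
      (tr y (suc zero) - 0ℚ) - T            ≡⟨ cong (_- T) (tr-ι-difference y (suc zero)) ⟩
      T - T                                 ≡⟨ ℚ.+-inverseʳ T ⟩
      0ℚ                                    ∎)
      where
      open ≡-Reasoning
      rearrange : ∀ x d c → d - c ≡ (x - c) - (x - d)
      rearrange = solve-∀ ℚ-ring

    from : D ≡ c → tr y ≈ ι c
    from refl u v = trans (tr-ι-difference y u) (sym (tr-ι-difference y v))

module TraceCondition (q : ℕ) (p-prime : Prime (suc (suc q))) (n : ℕ) where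

  open Cyclotomic (suc (suc q))
  open Residues (suc q)
  open Coefficients (suc q)
  open Trace q p-prime
  open Rationals
  open IndicatorCharacterisation
  import Data.Integer as ℤ
  open import Data.Sum.Function.Propositional using (_⊎-⇔_)
  open import Function.Construct.Composition using (_⇔-∘_)
  open AbelianGroup +F-abelianGroup using (identityˡ)
  open import Algebra.Properties.Group (AbelianGroup.group +F-abelianGroup) using (⁻¹-involutive)

  P : ℕ
  P = suc (suc q)

  TraceAdmissible : K → Set
  TraceAdmissible y = tr y ≈ ιℤ (ℤ.- ℤ.+ n) ⊎ tr y ≈ ιℤ (ℤ.+ P ℤ.- ℤ.+ n)

  traceAdmissible⇔ : ∀ y → TraceAdmissible y ⇔ Admissible (suc q) n (deviation y zero)
  traceAdmissible⇔ y =
    tr≈ιℤ⇔ (ℤ.- ℤ.+ n) (-n/1≡-fromℕ n) ⊎-⇔ tr≈ιℤ⇔ (ℤ.+ P ℤ.- ℤ.+ n) p-n/1≡p-n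
    where
    tr≈ιℤ⇔ : ∀ z {v} → z / 1 ≡ v → tr y ≈ ιℤ z ⇔ deviation y zero ≡ v
    tr≈ιℤ⇔ z refl = tr≈ι⇔ y _
    p-n/1≡p-n : (ℤ.+ P ℤ.- ℤ.+ n) / 1 ≡ fromℕ P - fromℕ n
    p-n/1≡p-n = trans (/1-homo-+ (ℤ.+ P) (ℤ.- ℤ.+ n)) (cong₂ _+_ (+n/1≡fromℕ P) (-n/1≡-fromℕ n))

  allTraceAdmissible⇔ : ∀ α → (∀ k → TraceAdmissible (α *K ζ^ℤ (ℤ.- k))) ⇔
                              (∀ b → Admissible (suc q) n (deviation α b))
  allTraceAdmissible⇔ α = mk⇔ to from
    where
    coefficient⇔ : ∀ m → TraceAdmissible (α *K ζ^ m) ⇔ Admissible (suc q) n (deviation α (zero -F m))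
    coefficient⇔ m = subst (λ v → TraceAdmissible (α *K ζ^ m) ⇔ Admissible (suc q) n v)
                           (deviation-*K-ζ^ α m) (traceAdmissible⇔ (α *K ζ^ m))

    to : (∀ k → TraceAdmissible (α *K ζ^ℤ (ℤ.- k))) → ∀ b → Admissible (suc q) n (deviation α b)
    to admissible b = subst (Admissible (suc q) n ∘ deviation α) 0--b≡b
                            (Equivalence.to (coefficient⇔ (-ᶠ b)) (admissible (ℤ.+ toℕ b)))
      where
      0--b≡b : zero -F (-ᶠ b) ≡ b
      0--b≡b = trans (identityˡ (-ᶠ (-ᶠ b))) (⁻¹-involutive b)

    from : (∀ b → Admissible (suc q) n (deviation α b)) → ∀ k → TraceAdmissible (α *K ζ^ℤ (ℤ.- k))
    from admissible k = Equivalence.from (coefficient⇔ ⟦ ℤ.- k ⟧) (admissible (zero -F ⟦ ℤ.- k ⟧))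

  characterisation : ∀ α → (∀ k → TraceAdmissible (α *K ζ^ℤ (ℤ.- k))) ⇔
                           Σ (Subset P) λ A → ∣ A ∣ ≡ n × α ≈ sumSubset A
  characterisation α =
    subsetSum⇔ ⇔-∘ (admissible⇔indicatorShape (suc q) n α ⇔-∘ allTraceAdmissible⇔ α)
    where
    subsetSum⇔ : IndicatorShape (suc q) n α ⇔ (Σ (Subset P) λ A → ∣ A ∣ ≡ n × α ≈ sumSubset A)
    subsetSum⇔ = mk⇔ (λ (A , card , d) → A , card , Equivalence.from (≈sumSubset⇔ α A) d)
                     (λ (A , card , d) → A , card , Equivalence.to (≈sumSubset⇔ α A) d)

open import Data.Nat using (_≤_; _∸_)
open import Data.Nat.Primality using (¬prime[0]; ¬prime[1])
open import Data.Integer using (ℤ; +_; -_; _-_)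

lemmaA3 : (p : ℕ) .{{_ : NonZero p}} → Prime p → (n : ℕ) → 1 ≤ n → n ≤ p ∸ 1 →
    (α : Cyclotomic.K p) → Cyclotomic.IsAlgInt p α →
    ((k : ℤ) →
        Cyclotomic._≈_ p (Cyclotomic.tr p (Cyclotomic._*K_ p α (Cyclotomic.ζ^ℤ p (- k)))) (Cyclotomic.ιℤ p (- (+ n)))
      ⊎ Cyclotomic._≈_ p (Cyclotomic.tr p (Cyclotomic._*K_ p α (Cyclotomic.ζ^ℤ p (- k)))) (Cyclotomic.ιℤ p (+ p - + n)))
    ⇔ Σ (Subset p) (λ A → ∣ A ∣ ≡ n × Cyclotomic._≈_ p α (Cyclotomic.sumSubset p A))
lemmaA3 zero          p-prime = ⊥-elim (¬prime[0] p-prime)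
lemmaA3 (suc zero)    p-prime = ⊥-elim (¬prime[1] p-prime)
-- The trace conditions alone determine α.
lemmaA3 (suc (suc q)) p-prime n _ _ α _ = TraceCondition.characterisation q p-prime n α
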